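{- Let $d>e\ge2$ be integers and let $f(z)=z^d+z^e+c\in\mathbb{Q}[z]$ with $c=a/b\in\mathbb{Q}$ and $|c|>2$. If $n\in\mathcal{Z}(f,0)$, then $n\le 6$.
   Context: Write $f^n(0)=A_n/B_n$ in lowest terms with $B_n>0$, where $f^n$ denotes the $n$-th iterate of $f$. A prime $p$ is a primitive prime divisor of $A_n$ if $p\mid A_n$ but $p\nmid A_m$ for all $1\le m<n$. The Zsigmondy set is $\mathcal{Z}(f,0)=\{n\ge1: A_n\text{ has no primitive prime divisor}\}$. -}

module Defs where

open import Data.Nat as ℕ using (ℕ; zero; suc)
open import Data.Integer as ℤ using (ℤ)
open import Data.Rational as ℚ using (ℚ; 0ℚ; 1ℚ; ↥_; _+_; _*_)
open import Data.Nat.Divisibility using (_∣_)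
open import Data.Nat.Primality using (Prime)
open import Data.Product using (_×_)
open import Relation.Nullary using (¬_)

_^ℚ_ : ℚ → ℕ → ℚ
x ^ℚ zero = 1ℚ
x ^ℚ suc k = x * (x ^ℚ k)

poly : ℕ → ℕ → ℚ → ℚ → ℚ
poly d e c z = (z ^ℚ d) + (z ^ℚ e) + c

iter : (ℚ → ℚ) → ℕ → ℚ → ℚ
iter f zero x = x
iter f (suc n) x = f (iter f n x)

-- A_n : numerator of f^n(0) in lowest terms (ℚ is normalised, denominator > 0)
A : (ℚ → ℚ) → ℕ → ℤ
A f n = ↥ (iter f n 0ℚ)

PrimitivePrimeDivisor : (ℚ → ℚ) → ℕ → ℕ → Set
PrimitivePrimeDivisor f n p =
  Prime p × (p ∣ ℤ.∣ A f n ∣) × (∀ m → 1 ℕ.≤ m → m ℕ.< n → ¬ (p ∣ ℤ.∣ A f m ∣))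

InZsigmondy : (ℚ → ℚ) → ℕ → Set
InZsigmondy f n = (1 ℕ.≤ n) × (∀ p → ¬ PrimitivePrimeDivisor f n p)

-- Write f^(k+1)(0) = M_k / b^(d^k), where b is the denominator of c. Then
-- M_(k+1) = M_k^d + M_k^e b^(d^k (d-e)) + a b^(d^(k+1) - 1), so every M_k is coprime to b and
-- M_k is the numerator A_(k+1). As 0 is a critical point of f of multiplicity e ≥ 2,
-- M_i^2 divides M_(j+i+1) b^(d^j) - M_j b^(d^(j+i+1)); this gives rigid divisibility: a prime
-- first dividing M_i divides every later M_n at most to its power in M_i. Since |c| > 2 the
-- orbit escapes quickly, |M_(k+1)| ≥ |M_k|^2 > |M_0 ⋯ M_k|. If A_(k+1) = M_k had no primitive
-- prime divisor, rigidity would make M_k divide M_0 ⋯ M_(k-1), which is too small. So the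
-- Zsigmondy set is in fact empty.
module Submission where

open import Defs
open import Data.Nat using (ℕ; _<_; _≤_)
open import Data.Rational using (ℚ; ∣_∣; _>_; _/_)
open import Data.Integer using (+_)

open import Data.Nat using (zero; suc)
open import Data.Product using (∃-syntax; _×_; _,_; proj₁; proj₂)
open import Data.Sum using (inj₁; inj₂)
open import Data.Empty using (⊥-elim)
open import Relation.Nullary using (¬_; yes; no; contradiction)
open import Relation.Binary.PropositionalEquality

module _ where

  open import Data.Nat using (_+_; _∸_; _*_; _^_; NonZero; s≤s; z≤n; >-nonZero)
  open import Data.Nat.Properties
  open import Data.Nat.Divisibility
  open import Data.Nat.Coprimality as Coprime using (Coprime; coprime-divisor)
  open import Data.Nat.Primality using (Prime; prime⇒irreducible; prime⇒nonZero; ¬prime[1])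
  open import Data.Nat.Primality.Factorisation using (factorise; PrimeFactorisation)
  open import Data.Nat.ListAction using (product)
  open import Data.Nat.Induction using (<-rec)
  open import Data.Nat.Tactic.RingSolver using (solve-∀)
  open import Data.List using ([]; _∷_)
  open import Data.List.Relation.Unary.All using (All; []; _∷_)
  open import Level using (0ℓ)
  open import Relation.Unary using (Pred; Decidable)
  open import Algebra.Properties.CommutativeSemigroup *-commutativeSemigroup using (x∙yz≈y∙xz; x∙yz≈yx∙z)

  m∣m^n : ∀ m {n} → 1 ≤ n → m ∣ m ^ n
  m∣m^n m {suc n} _ = m∣m*n (m ^ n)

  ^-pred-* : ∀ m {n} → 1 ≤ n → m ^ (n ∸ 1) * m ≡ m ^ n
  ^-pred-* m {suc n} _ = *-comm (m ^ n) m

  ^-^-suc : ∀ m n k → m ^ (n ^ suc k) ≡ (m ^ (n ^ k)) ^ n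
  ^-^-suc m n k = trans (cong (m ^_) (*-comm n (n ^ k))) (sym (^-*-assoc m (n ^ k) n))

  coprime-*ˡ : ∀ {m n o} → Coprime m o → Coprime n o → Coprime (m * n) o
  coprime-*ˡ {m} m⊥o n⊥o (i∣mn , i∣o) =
    n⊥o (coprime-divisor (λ (j∣i , j∣m) → m⊥o (j∣m , ∣-trans j∣i i∣o)) i∣mn , i∣o)

  coprime-^ˡ : ∀ {m n} k → Coprime m n → Coprime (m ^ k) n
  coprime-^ˡ zero    _   (i∣1 , _) = ∣1⇒≡1 i∣1
  coprime-^ˡ (suc k) m⊥n = coprime-*ˡ m⊥n (coprime-^ˡ k m⊥n)

  coprime-^ʳ : ∀ {m n} k → Coprime m n → Coprime m (n ^ k)
  coprime-^ʳ k m⊥n = Coprime.sym (coprime-^ˡ k (Coprime.sym m⊥n))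

  prime∤⇒coprime : ∀ {p n} → Prime p → ¬ p ∣ n → Coprime p n
  prime∤⇒coprime p-prime p∤n (i∣p , i∣n) with prime⇒irreducible p-prime i∣p
  ... | inj₁ i≡1 = i≡1
  ... | inj₂ refl = contradiction i∣n p∤n

  prime^∣*∤⇒∣ : ∀ {p m n} r → Prime p → ¬ p ∣ n → p ^ r ∣ m * n → p ^ r ∣ m
  prime^∣*∤⇒∣ {p} {m} {n} r p-prime p∤n p^r∣mn =
    coprime-divisor (coprime-^ˡ r (prime∤⇒coprime p-prime p∤n)) (subst (p ^ r ∣_) (*-comm m n) p^r∣mn)

  infix 4 _∣ₚ_
  _∣ₚ_ : ℕ → ℕ → Set
  m ∣ₚ n = ∀ {p} r → Prime p → p ^ r ∣ m → p ^ r ∣ n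

  ∣ₚ-cancelˡ : ∀ {q m n} → Prime q → q * m ∣ₚ q * n → m ∣ₚ n
  ∣ₚ-cancelˡ {q} {m} {n} q-prime qm∣ₚqn {p} r p-prime p^r∣m with p ≟ q
  ... | yes refl = *-cancelˡ-∣ p {{prime⇒nonZero p-prime}} (qm∣ₚqn (suc r) p-prime (*-monoʳ-∣ p p^r∣m))
  ... | no p≢q = prime^∣*∤⇒∣ r p-prime p∤q
                   (subst (p ^ r ∣_) (*-comm q n) (qm∣ₚqn r p-prime (∣n⇒∣m*n q p^r∣m)))
    where
    p∤q : ¬ p ∣ q
    p∤q p∣q with prime⇒irreducible q-prime p∣q
    ... | inj₁ refl = ¬prime[1] p-prime
    ... | inj₂ p≡q = p≢q p≡q

  ∣ₚ⇒∣ : ∀ {m n} .{{_ : NonZero m}} → m ∣ₚ n → m ∣ n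
  ∣ₚ⇒∣ {m} m∣ₚn = subst (_∣ _) (sym isFactorisation)
                   (go factors factorsPrime (subst (_∣ₚ _) isFactorisation m∣ₚn))
    where
    open PrimeFactorisation (factorise m)
    prime-∣ : ∀ {q k n} → Prime q → q ∣ k → k ∣ₚ n → q ∣ n
    prime-∣ {q} q-prime q∣k k∣ₚn =
      subst (_∣ _) (*-identityʳ q) (k∣ₚn 1 q-prime (subst (_∣ _) (sym (*-identityʳ q)) q∣k))
    go : ∀ {n} qs → All Prime qs → product qs ∣ₚ n → product qs ∣ n
    go []       _                    _       = 1∣ _
    go (q ∷ qs) (q-prime ∷ qs-prime) qqs∣ₚn with prime-∣ q-prime (m∣m*n (product qs)) qqs∣ₚn
    ... | divides n′ refl = subst (q * product qs ∣_) (*-comm q n′)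
            (*-monoʳ-∣ q (go qs qs-prime (∣ₚ-cancelˡ q-prime (subst (q * product qs ∣ₚ_) (*-comm n′ q) qqs∣ₚn))))

  least : ∀ {P : Pred ℕ 0ℓ} → Decidable P → ∀ {n} → P n → ∃[ i ] i ≤ n × P i × (∀ {j} → j < i → ¬ P j)
  least {P} P? = <-rec _ step _
    where
    step : ∀ n → (∀ {m} → m < n → P m → ∃[ i ] i ≤ m × P i × (∀ {j} → j < i → ¬ P j)) →
           P n → ∃[ i ] i ≤ n × P i × (∀ {j} → j < i → ¬ P j)
    step n rec Pn with anyUpTo? P? n
    ... | yes (m , m<n , Pm) = let i , i≤m , Pi , minimal = rec m<n Pm in
                               i , ≤-trans i≤m (<⇒≤ m<n) , Pi , minimal
    ... | no ∄m<n            = n , ≤-refl , Pn , λ j<n Pj → ∄m<n (_ , j<n , Pj)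

  -- What t i ² ∣ t (1 + j + i) · u j - t j · u (1 + j + i) says about common divisors.
  SquareCongruence : (t u : ℕ → ℕ) → Set
  SquareCongruence t u = ∀ {q} i j → q ∣ t i * t i → q ∣ t (suc (j + i)) → q ∣ t j * u (suc (j + i))

  -- For i < n, by induction on r: p ∣ t i and p ^ r ∣ t i give p ^ (1 + r) ∣ t i * t i, so the
  -- congruence and p ∤ u move p ^ (1 + r) from t n down to t j with j < n, where i ≤ j by the
  -- minimality of i.
  rigid-divisibility : ∀ {t u} → SquareCongruence t u → ∀ {p i} → Prime p → (∀ n → ¬ p ∣ u n) →
          p ∣ t i → (∀ {j} → j < i → ¬ p ∣ t j) → ∀ {n} → i ≤ n → ∀ r → p ^ r ∣ t n → p ^ r ∣ t i
  rigid-divisibility {t} {u} square-congruence {p} {i} p-prime p∤u p∣tᵢ first = <-rec _ step _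
    where
    step : ∀ n → (∀ {m} → m < n → i ≤ m → ∀ r → p ^ r ∣ t m → p ^ r ∣ t i) →
           i ≤ n → ∀ r → p ^ r ∣ t n → p ^ r ∣ t i
    step n rec i≤n r with m≤n⇒m<n∨m≡n i≤n
    ... | inj₂ refl = λ p^r∣tᵢ → p^r∣tᵢ
    ... | inj₁ i<n  = subst (λ m → p ^ r ∣ t m → p ^ r ∣ t i) n≡ (descend r)
      where
      j = n ∸ suc i
      n≡ : suc (j + i) ≡ n
      n≡ = trans (sym (+-suc j i)) (m∸n+n≡m i<n)
      descend : ∀ r → p ^ r ∣ t (suc (j + i)) → p ^ r ∣ t i
      descend zero    _        = 1∣ _
      descend (suc r) p^1+r∣tₙ = rec (subst (j <_) n≡ (s≤s (m≤m+n j i))) i≤j (suc r) p^1+r∣tⱼ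
        where
        p^1+r∣tⱼ : p ^ suc r ∣ t j
        p^1+r∣tⱼ = prime^∣*∤⇒∣ (suc r) p-prime (p∤u _)
          (square-congruence i j (*-pres-∣ p∣tᵢ (descend r (∣-trans (n∣m*n p) p^1+r∣tₙ))) p^1+r∣tₙ)
        i≤j : i ≤ j
        i≤j = ≮⇒≥ (λ j<i → first j<i (∣-trans (m∣m*n (p ^ r)) p^1+r∣tⱼ))

  2*D<t : ∀ {b α D t} .{{_ : NonZero D}} → 2 * b < α → α * D ≤ b * t → 2 * D < t
  2*D<t {b} {α} {D} {t} 2b<α αD≤bt = *-cancelˡ-< b (2 * D) t (begin-strict
    b * (2 * D)  ≡⟨ x∙yz≈yx∙z b 2 D ⟩
    2 * b * D    <⟨ *-monoˡ-< D 2b<α ⟩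
    α * D        ≤⟨ αD≤bt ⟩
    b * t        ∎)
    where open ≤-Reasoning

  ^-mixed-≤ : ∀ {t D} e {n} → D ≤ t → e ≤ n → t ^ e * D ^ (n ∸ e) ≤ t ^ n
  ^-mixed-≤ {t} {D} e {n} D≤t e≤n = begin
    t ^ e * D ^ (n ∸ e)  ≤⟨ *-monoʳ-≤ (t ^ e) (^-monoˡ-≤ (n ∸ e) D≤t) ⟩
    t ^ e * t ^ (n ∸ e)  ≡⟨ ^-distribˡ-+-* t e (n ∸ e) ⟨
    t ^ (e + (n ∸ e))    ≡⟨ cong (t ^_) (m+[n∸m]≡n e≤n) ⟩
    t ^ n                ∎
    where open ≤-Reasoning

  -- With u = t ^ (1 + s), the two lower terms of the triangle inequality for f are at most D t u and
  -- D² u, and 2 D < t turns t ^ (3 + s) = t² u into (t + D²) u ≤ T.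
  module Growth {s e t D T E α b : ℕ} .{{_ : NonZero b}} .{{_ : NonZero D}}
    (e≤2+s : e ≤ 2 + s) (2b<α : 2 * b < α) (αD≤bt : α * D ≤ b * t) (Eb≡D³⁺ˢ : E * b ≡ D ^ (3 + s))
    (triangle : t ^ (3 + s) ≤ T + t ^ e * D ^ (3 + s ∸ e) + α * E)
    where

    open ≤-Reasoning

    u : ℕ
    u = t ^ suc s

    2D<t : 2 * D < t
    2D<t = 2*D<t {b} 2b<α αD≤bt

    D≤t : D ≤ t
    D≤t = ≤-trans (m≤n*m D 2) (<⇒≤ 2D<t)

    middle-term-≤ : t ^ e * D ^ (3 + s ∸ e) ≤ D * (t * u)
    middle-term-≤ = begin
      t ^ e * D ^ (3 + s ∸ e)        ≡⟨ cong (λ k → t ^ e * D ^ k) (+-∸-assoc 1 e≤2+s) ⟩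
      t ^ e * (D * D ^ (2 + s ∸ e))  ≡⟨ x∙yz≈y∙xz (t ^ e) D (D ^ (2 + s ∸ e)) ⟩
      D * (t ^ e * D ^ (2 + s ∸ e))  ≤⟨ *-monoʳ-≤ D (^-mixed-≤ e D≤t e≤2+s) ⟩
      D * (t * u)                    ∎

    tD²⁺ˢ≤DDu : t * D ^ (2 + s) ≤ D * D * u
    tD²⁺ˢ≤DDu = begin
      t * (D * (D * D ^ s))  ≡⟨ rearrange t D (D ^ s) ⟩
      D * D * (t * D ^ s)    ≤⟨ *-monoʳ-≤ (D * D) (*-monoʳ-≤ t (^-monoˡ-≤ s D≤t)) ⟩
      D * D * u              ∎
      where
      rearrange : ∀ x y z → x * (y * (y * z)) ≡ y * y * (x * z)
      rearrange = solve-∀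

    αD³⁺ˢ≤btD²⁺ˢ : α * D ^ (3 + s) ≤ b * (t * D ^ (2 + s))
    αD³⁺ˢ≤btD²⁺ˢ = begin
      α * (D * D ^ (2 + s))  ≡⟨ *-assoc α D _ ⟨
      α * D * D ^ (2 + s)    ≤⟨ *-monoˡ-≤ (D ^ (2 + s)) αD≤bt ⟩
      b * t * D ^ (2 + s)    ≡⟨ *-assoc b t _ ⟩
      b * (t * D ^ (2 + s))  ∎

    last-term-≤ : α * E ≤ D * D * u
    last-term-≤ = ≤-trans (*-cancelʳ-≤ (α * E) (t * D ^ (2 + s)) b (begin
      α * E * b              ≡⟨ *-assoc α E b ⟩
      α * (E * b)            ≡⟨ cong (α *_) Eb≡D³⁺ˢ ⟩
      α * D ^ (3 + s)        ≤⟨ αD³⁺ˢ≤btD²⁺ˢ ⟩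
      b * (t * D ^ (2 + s))  ≡⟨ *-comm b _ ⟩
      t * D ^ (2 + s) * b    ∎)) tD²⁺ˢ≤DDu

    [t+D*D]u≤T : (t + D * D) * u ≤ T
    [t+D*D]u≤T = +-cancelˡ-≤ ((D * t + D * D) * u) _ _ (begin
      (D * t + D * D) * u + (t + D * D) * u  ≡⟨ *-distribʳ-+ u (D * t + D * D) _ ⟨
      (D * t + D * D + (t + D * D)) * u      ≤⟨ *-monoˡ-≤ u coefficient-≤ ⟩
      t * t * u                              ≡⟨ *-assoc t t u ⟩
      t ^ (3 + s)                            ≤⟨ triangle ⟩
      T + t ^ e * D ^ (3 + s ∸ e) + α * E    ≤⟨ +-mono-≤ (+-monoʳ-≤ T middle-term-≤) last-term-≤ ⟩
      T + D * (t * u) + D * D * u            ≡⟨ collect T D t u ⟩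
      (D * t + D * D) * u + T                ∎)
      where
      collect : ∀ T D t u → T + D * (t * u) + D * D * u ≡ (D * t + D * D) * u + T
      collect = solve-∀
      expand : ∀ D t → D * t + D * D + (t + D * D) ≡ D * t + D * (2 * D) + t
      expand = solve-∀
      factor : ∀ D t → D * t + D * t + t ≡ t * suc (2 * D)
      factor = solve-∀
      coefficient-≤ : D * t + D * D + (t + D * D) ≤ t * t
      coefficient-≤ = begin
        D * t + D * D + (t + D * D)  ≡⟨ expand D t ⟩
        D * t + D * (2 * D) + t      ≤⟨ +-monoˡ-≤ t (+-monoʳ-≤ (D * t) (*-monoʳ-≤ D (<⇒≤ 2D<t))) ⟩
        D * t + D * t + t            ≡⟨ factor D t ⟩
        t * suc (2 * D)              ≤⟨ *-monoʳ-≤ t 2D<t ⟩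
        t * t                        ∎

    t*t≤T : t * t ≤ T
    t*t≤T = begin
      t * t             ≤⟨ *-monoʳ-≤ t t≤u ⟩
      t * u             ≤⟨ *-monoˡ-≤ u (m≤m+n t (D * D)) ⟩
      (t + D * D) * u   ≤⟨ [t+D*D]u≤T ⟩
      T                 ∎
      where
      t≤u : t ≤ u
      t≤u = m≤m*n t (t ^ s) {{m^n≢0 t s {{>-nonZero (≤-<-trans z≤n 2D<t)}}}}

    αD³⁺ˢ≤bT : α * D ^ (3 + s) ≤ b * T
    αD³⁺ˢ≤bT = begin
      α * D ^ (3 + s)        ≤⟨ αD³⁺ˢ≤btD²⁺ˢ ⟩
      b * (t * D ^ (2 + s))  ≤⟨ *-monoʳ-≤ b (≤-trans tD²⁺ˢ≤DDu (*-monoˡ-≤ u (m≤n+m (D * D) t))) ⟩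
      b * ((t + D * D) * u)  ≤⟨ *-monoʳ-≤ b [t+D*D]u≤T ⟩
      b * T                  ∎

  growth-step : ∀ {d e t D T E α b} .{{_ : NonZero b}} .{{_ : NonZero D}} → 2 ≤ e → e < d →
    2 * b < α → α * D ≤ b * t → E * b ≡ D ^ d → t ^ d ≤ T + t ^ e * D ^ (d ∸ e) + α * E →
    t * t ≤ T × α * D ^ d ≤ b * T
  growth-step {suc (suc (suc s))} _ (s≤s e≤2+s) 2b<α αD≤bt Eb≡Dᵈ triangle = t*t≤T , αD³⁺ˢ≤bT
    where open Growth e≤2+s 2b<α αD≤bt Eb≡Dᵈ triangle
  growth-step {0}             _             ()
  growth-step {1}             (s≤s (s≤s _)) (s≤s ())
  growth-step {2}             (s≤s (s≤s _)) (s≤s (s≤s ()))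

module _ where

  open import Data.Nat as ℕ using (_∸_; NonZero; s≤s; z≤n)
  import Data.Nat.Properties as ℕ
  import Data.Nat.Divisibility as ℕ
  open import Data.Integer as ℤ using (ℤ; _*_; _+_; _-_; _^_)
  import Data.Integer.Properties as ℤ
  open import Data.Integer.Divisibility.Signed
    using (_∣_; divides; ∣ᵤ⇒∣; ∣⇒∣ᵤ; ∣m∣n⇒∣m+n; ∣m∣n⇒∣m-n; ∣m⇒∣m*n; ∣n⇒∣m*n; ∣m+n∣n⇒∣m; ∣-trans)
  open import Data.Integer.GCD using (gcd)
  open import Data.Integer.Tactic.RingSolver using (solve-∀)
  open import Data.Nat.Coprimality as Coprime using (Coprime; coprime-divisor)
  open import Data.Nat.Primality using (Prime; ¬prime[1])
  open import Data.Rational as ℚ using (mkℚ; ↥_; ↧_; ↧ₙ_; 0ℚ; *<*)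
  import Data.Rational.Properties as ℚ
  open import Algebra.Properties.CommutativeSemigroup ℤ.*-commutativeSemigroup
    using (interchange; x∙yz≈xz∙y; xy∙z≈xz∙y; x∙yz≈yx∙z)

  pos-^ : ∀ m n → (+ m) ^ n ≡ + (m ℕ.^ n)
  pos-^ m zero    = refl
  pos-^ m (suc n) = trans (cong (+ m *_) (pos-^ m n)) (sym (ℤ.pos-* m (m ℕ.^ n)))

  abs-^ : ∀ i n → ℤ.∣ i ^ n ∣ ≡ ℤ.∣ i ∣ ℕ.^ n
  abs-^ i zero    = refl
  abs-^ i (suc n) = trans (ℤ.abs-* i (i ^ n)) (cong (ℤ.∣ i ∣ ℕ.*_) (abs-^ i n))

  ^-nonZero : ∀ i n .{{_ : ℤ.NonZero i}} → ℤ.NonZero (i ^ n)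
  ^-nonZero i n = subst NonZero (sym (abs-^ i n)) (ℕ.m^n≢0 ℤ.∣ i ∣ n)

  ^-split : ∀ i {m n} → m ≤ n → i ^ n ≡ i ^ (n ∸ m) * i ^ m
  ^-split i {m} {n} m≤n = trans (cong (i ^_) (sym (ℕ.m∸n+n≡m m≤n))) (ℤ.^-distribˡ-+-* i (n ∸ m) m)

  square∣^ : ∀ i {n} → 2 ≤ n → i * i ∣ i ^ n
  square∣^ i {suc (suc n)} (s≤s (s≤s _)) = divides (i ^ n) (x∙xy≈y∙xx i (i ^ n))
    where
    x∙xy≈y∙xx : ∀ x y → x * (x * y) ≡ y * (x * x)
    x∙xy≈y∙xx = solve-∀

  ∣-cross-^ : ∀ {m X Y X′ Y′} n → m ∣ X * Y′ - X′ * Y → m ∣ X ^ n * Y′ ^ n - X′ ^ n * Y ^ n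
  ∣-cross-^ zero _ = divides (+ 0) refl
  ∣-cross-^ {m} {X} {Y} {X′} {Y′} (suc n) m∣XY′-X′Y =
    subst (m ∣_) (sym (telescope X Y X′ Y′ (X ^ n) (Y ^ n) (X′ ^ n) (Y′ ^ n)))
    (∣m∣n⇒∣m+n (∣n⇒∣m*n (X * Y′) (∣-cross-^ n m∣XY′-X′Y)) (∣n⇒∣m*n (X′ ^ n * Y ^ n) m∣XY′-X′Y))
    where
    telescope : ∀ x y x′ y′ xₙ yₙ x′ₙ y′ₙ →
      x * xₙ * (y′ * y′ₙ) - x′ * x′ₙ * (y * yₙ) ≡ x * y′ * (xₙ * y′ₙ - x′ₙ * yₙ) + x′ₙ * yₙ * (x * y′ - x′ * y)
    telescope = solve-∀

  infix 4 _≃_/_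
  record _≃_/_ (x : ℚ) (N D : ℤ) : Set where
    constructor cross
    field cross-eq : ↥ x * D ≡ N * ↧ x

  /-≃ : ∀ i n .{{_ : ℕ.NonZero n}} → i ℚ./ n ≃ i / + n
  /-≃ i n = cross (begin
    ↥ x * + n        ≡⟨ cong (↥ x *_) (ℚ.↧-/ i n) ⟨
    ↥ x * (↧ x * g)  ≡⟨ x∙yz≈xz∙y (↥ x) (↧ x) g ⟩
    ↥ x * g * ↧ x    ≡⟨ cong (_* ↧ x) (ℚ.↥-/ i n) ⟩
    i * ↧ x          ∎)
    where
    open ≡-Reasoning
    x = i ℚ./ n
    g = gcd i (+ n)

  ≃-cross : ∀ {x N D N′ D′} → x ≃ N / D → N * D′ ≡ N′ * D → .{{ℤ.NonZero D}} → x ≃ N′ / D′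
  ≃-cross {x} {N} {D} {N′} {D′} (cross eq) eq′ = cross (ℤ.*-cancelʳ-≡ _ _ D (begin
    ↥ x * D′ * D     ≡⟨ xy∙z≈xz∙y (↥ x) D′ D ⟩
    ↥ x * D * D′     ≡⟨ cong (_* D′) eq ⟩
    N * ↧ x * D′     ≡⟨ xy∙z≈xz∙y N (↧ x) D′ ⟩
    N * D′ * ↧ x     ≡⟨ cong (_* ↧ x) eq′ ⟩
    N′ * D * ↧ x     ≡⟨ xy∙z≈xz∙y N′ D (↧ x) ⟩
    N′ * ↧ x * D     ∎))
    where open ≡-Reasoning

  *-≃ : ∀ {x y N₁ D₁ N₂ D₂} → x ≃ N₁ / D₁ → y ≃ N₂ / D₂ → x ℚ.* y ≃ N₁ * N₂ / D₁ * D₂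
  *-≃ {x@(mkℚ _ _ _)} {y@(mkℚ _ _ _)} {N₁} {D₁} {N₂} {D₂} (cross eq₁) (cross eq₂) =
    ≃-cross (/-≃ (↥ x * ↥ y) (↧ₙ x ℕ.* ↧ₙ y)) (begin
      ↥ x * ↥ y * (D₁ * D₂)                ≡⟨ interchange (↥ x) (↥ y) D₁ D₂ ⟩
      ↥ x * D₁ * (↥ y * D₂)                ≡⟨ cong₂ _*_ eq₁ eq₂ ⟩
      N₁ * ↧ x * (N₂ * ↧ y)                ≡⟨ interchange N₁ (↧ x) N₂ (↧ y) ⟩
      N₁ * N₂ * (↧ x * ↧ y)                ≡⟨ cong (N₁ * N₂ *_) (ℤ.pos-* (↧ₙ x) (↧ₙ y)) ⟨
      N₁ * N₂ * + (↧ₙ x ℕ.* ↧ₙ y)          ∎)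
    where open ≡-Reasoning

  +-≃ : ∀ {x y N₁ D₁ N₂ D₂} → x ≃ N₁ / D₁ → y ≃ N₂ / D₂ → x ℚ.+ y ≃ N₁ * D₂ + N₂ * D₁ / D₁ * D₂
  +-≃ {x@(mkℚ _ _ _)} {y@(mkℚ _ _ _)} {N₁} {D₁} {N₂} {D₂} (cross eq₁) (cross eq₂) =
    ≃-cross (/-≃ (↥ x * ↧ y + ↥ y * ↧ x) (↧ₙ x ℕ.* ↧ₙ y)) (begin
      (↥ x * ↧ y + ↥ y * ↧ x) * (D₁ * D₂)                  ≡⟨ expand (↥ x) (↧ y) (↥ y) (↧ x) D₁ D₂ ⟩
      (↥ x * D₁) * (↧ y * D₂) + (↥ y * D₂) * (↧ x * D₁)
        ≡⟨ cong₂ (λ u v → u * (↧ y * D₂) + v * (↧ x * D₁)) eq₁ eq₂ ⟩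
      (N₁ * ↧ x) * (↧ y * D₂) + (N₂ * ↧ y) * (↧ x * D₁)    ≡⟨ collect N₁ (↧ x) (↧ y) D₂ N₂ D₁ ⟩
      (N₁ * D₂ + N₂ * D₁) * (↧ x * ↧ y)
        ≡⟨ cong ((N₁ * D₂ + N₂ * D₁) *_) (ℤ.pos-* (↧ₙ x) (↧ₙ y)) ⟨
      (N₁ * D₂ + N₂ * D₁) * + (↧ₙ x ℕ.* ↧ₙ y)              ∎)
    where
    open ≡-Reasoning
    expand : ∀ a b c d u v → (a * b + c * d) * (u * v) ≡ (a * u) * (b * v) + (c * v) * (d * u)
    expand = solve-∀
    collect : ∀ a b c d u v → (a * b) * (c * d) + (u * c) * (b * v) ≡ (a * d + u * v) * (b * c)
    collect = solve-∀

  ^-≃ : ∀ {x N D} n → x ≃ N / D → x ^ℚ n ≃ N ^ n / D ^ n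
  ^-≃ zero    _ = cross refl
  ^-≃ (suc n) r = *-≃ r (^-≃ n r)

  ↥↧-coprime : ∀ x → Coprime ℤ.∣ ↥ x ∣ (↧ₙ x)
  ↥↧-coprime (mkℚ _ _ coprime) = Coprime.recompute coprime

  ↥-≃ : ∀ {x N n} → x ≃ N / + n → Coprime ℤ.∣ N ∣ n → ↥ x ≡ N
  ↥-≃ {x} {N} {n} (cross eq) N⊥n =
    ℤ.*-cancelʳ-≡ (↥ x) N (↧ x) (trans (cong (λ m → ↥ x * + m) (sym n≡↧x)) eq)
    where
    ∣eq∣ : ℤ.∣ ↥ x ∣ ℕ.* n ≡ ℤ.∣ N ∣ ℕ.* ↧ₙ x
    ∣eq∣ = trans (sym (ℤ.abs-* (↥ x) (+ n))) (trans (cong ℤ.∣_∣ eq) (ℤ.abs-* N (↧ x)))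
    n≡↧x : n ≡ ↧ₙ x
    n≡↧x = ℕ.∣-antisym (coprime-divisor (Coprime.sym N⊥n) (ℕ.divides ℤ.∣ ↥ x ∣ (sym ∣eq∣)))
                     (coprime-divisor (Coprime.sym (↥↧-coprime x)) (ℕ.divides ℤ.∣ N ∣ ∣eq∣))

  +-≃-common : ∀ {x y N₁ N₂ D} → x ≃ N₁ / D → y ≃ N₂ / D → .{{_ : ℤ.NonZero D}} → x ℚ.+ y ≃ N₁ + N₂ / D
  +-≃-common {N₁ = N₁} {N₂} {D} r₁ r₂ = ≃-cross (+-≃ r₁ r₂) (factor N₁ N₂ D) {{ℤ.i*j≢0 D D}}
    where
    factor : ∀ n₁ n₂ d → (n₁ * d + n₂ * d) * d ≡ (n₁ + n₂) * (d * d)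
    factor = solve-∀

  ≃-↥/↧ : ∀ x → x ≃ ↥ x / ↧ x
  ≃-↥/↧ x = cross refl

  2<∣q∣⇒2↧q<∣↥q∣ : ∀ q → ∣ q ∣ > (+ 2) / 1 → 2 ℕ.* ↧ₙ q < ℤ.∣ ↥ q ∣
  2<∣q∣⇒2↧q<∣↥q∣ (mkℚ p q-1 _) (*<* 2↧q<∣↥q∣) = subst (2 ℕ.* ℕ.suc q-1 <_) (ℕ.*-identityʳ ℤ.∣ p ∣)
    (ℤ.drop‿+<+ (subst₂ ℤ._<_ (sym (ℤ.pos-* 2 (ℕ.suc q-1))) (sym (ℤ.pos-* ℤ.∣ p ∣ 1)) 2↧q<∣↥q∣))

  module Orbit {d e : ℕ} (2≤e : 2 ≤ e) (e<d : e < d) (c : ℚ) where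

    a : ℤ
    a = ↥ c

    b : ℕ
    b = ↧ₙ c

    f : ℚ → ℚ
    f = poly d e c

    e≤d : e ≤ d
    e≤d = ℕ.<⇒≤ e<d

    2≤d : 2 ≤ d
    2≤d = ℕ.≤-trans 2≤e e≤d

    1≤e : 1 ≤ e
    1≤e = ℕ.≤-trans (s≤s z≤n) 2≤e

    1≤d : 1 ≤ d
    1≤d = ℕ.≤-trans 1≤e e≤d

    instance
      d-nonZero : NonZero d
      d-nonZero = ℕ.>-nonZero 1≤d

    denom : ℕ → ℕ
    denom k = b ℕ.^ (d ℕ.^ k)

    cofactor : ℕ → ℕ
    cofactor k = b ℕ.^ (d ℕ.^ suc k ∸ 1)

    denom-nonZero : ∀ k → NonZero (denom k)
    denom-nonZero k = ℕ.m^n≢0 b (d ℕ.^ k)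

    denom-suc : ∀ k → denom (suc k) ≡ denom k ℕ.^ d
    denom-suc = ^-^-suc b d

    cofactor-* : ∀ k → cofactor k ℕ.* b ≡ denom k ℕ.^ d
    cofactor-* k = trans (^-pred-* b (ℕ.m^n>0 d (suc k))) (denom-suc k)

    +denom-suc : ∀ k → + denom (suc k) ≡ (+ denom k) ^ d
    +denom-suc k = trans (cong +_ (denom-suc k)) (sym (pos-^ (denom k) d))

    +cofactor-* : ∀ k → + cofactor k * ↧ c ≡ (+ denom k) ^ d
    +cofactor-* k =
      trans (sym (ℤ.pos-* (cofactor k) b)) (trans (cong +_ (cofactor-* k)) (sym (pos-^ (denom k) d)))

    -- f homogenised; E stands for Y ^ d / b.
    Φ : ℤ → ℤ → ℤ → ℤ
    Φ X Y E = X ^ d + X ^ e * Y ^ (d ∸ e) + a * E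

    num : ℕ → ℤ
    num zero    = a
    num (suc k) = Φ (num k) (+ denom k) (+ cofactor k)

    ∣num∣ : ℕ → ℕ
    ∣num∣ k = ℤ.∣ num k ∣

    f-≃ : ∀ {x X Y E} → x ≃ X / Y → E * ↧ c ≡ Y ^ d → .{{_ : ℤ.NonZero Y}} → f x ≃ Φ X Y E / Y ^ d
    f-≃ {x} {X} {Y} {E} x≃X/Y EB≡Yᵈ =
      +-≃-common (+-≃-common (^-≃ d x≃X/Y) xᵉ≃) c≃
      where
      open ≡-Reasoning
      instance
        Yᵈ-nonZero : ℤ.NonZero (Y ^ d)
        Yᵈ-nonZero = ^-nonZero Y d
      xᵉ≃ : x ^ℚ e ≃ X ^ e * Y ^ (d ∸ e) / Y ^ d
      xᵉ≃ = ≃-cross (^-≃ e x≃X/Y) (begin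
        X ^ e * Y ^ d                    ≡⟨ cong (X ^ e *_) (^-split Y e≤d) ⟩
        X ^ e * (Y ^ (d ∸ e) * Y ^ e)    ≡⟨ ℤ.*-assoc (X ^ e) _ _ ⟨
        X ^ e * Y ^ (d ∸ e) * Y ^ e      ∎) {{^-nonZero Y e}}
      c≃ : c ≃ a * E / Y ^ d
      c≃ = ≃-cross (≃-↥/↧ c) (begin
        a * Y ^ d        ≡⟨ cong (a *_) EB≡Yᵈ ⟨
        a * (E * ↧ c)    ≡⟨ ℤ.*-assoc a E (↧ c) ⟨
        a * E * ↧ c      ∎)

    iter-≃ : ∀ k → iter f (suc k) 0ℚ ≃ num k / + denom k
    iter-≃ zero    = subst (λ x → x ≃ a / + denom 0) (sym f[0]≡c)
                       (subst (λ n → c ≃ a / + n) (sym (ℕ.^-identityʳ b)) (≃-↥/↧ c))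
      where
      open ≡-Reasoning
      0ᵏ≡0 : ∀ {k} → 1 ≤ k → 0ℚ ^ℚ k ≡ 0ℚ
      0ᵏ≡0 {suc k} _ = ℚ.*-zeroˡ (0ℚ ^ℚ k)
      f[0]≡c : f 0ℚ ≡ c
      f[0]≡c = begin
        0ℚ ^ℚ d ℚ.+ 0ℚ ^ℚ e ℚ.+ c  ≡⟨ cong₂ (λ u v → u ℚ.+ v ℚ.+ c) (0ᵏ≡0 1≤d) (0ᵏ≡0 1≤e) ⟩
        0ℚ ℚ.+ 0ℚ ℚ.+ c            ≡⟨ ℚ.+-identityˡ c ⟩
        c                          ∎
    iter-≃ (suc k) = subst (λ D → f (iter f (suc k) 0ℚ) ≃ num (suc k) / D) (sym (+denom-suc k))
                       (f-≃ (iter-≃ k) (+cofactor-* k) {{denom-nonZero k}})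

    b∣cofactor : ∀ k → b ℕ.∣ cofactor k
    b∣cofactor k = m∣m^n b (ℕ.m<n⇒0<n∸m (ℕ.≤-trans 2≤d (ℕ.m≤m*n d (d ℕ.^ k) {{ℕ.m^n≢0 d k}})))

    b∣denom^[d∸e] : ∀ k → b ℕ.∣ denom k ℕ.^ (d ∸ e)
    b∣denom^[d∸e] k = ℕ.∣-trans (m∣m^n b (ℕ.m^n>0 d k)) (m∣m^n (denom k) (ℕ.m<n⇒0<n∸m e<d))

    num-coprime : ∀ k → Coprime (∣num∣ k) b
    num-coprime zero = ↥↧-coprime c
    num-coprime (suc k) {x} (x∣Φ , x∣b) = coprime-^ˡ d (num-coprime k) (x∣∣num∣ᵈ , x∣b)
      where
      M = num k
      ℕ⇒ℤ : ∀ {n} → b ℕ.∣ n → + x ∣ + n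
      ℕ⇒ℤ b∣n = ∣ᵤ⇒∣ (ℕ.∣-trans x∣b b∣n)
      x∣Mᵈ : + x ∣ M ^ d
      x∣Mᵈ = ∣m+n∣n⇒∣m (∣m+n∣n⇒∣m (∣ᵤ⇒∣ x∣Φ) (∣n⇒∣m*n a (ℕ⇒ℤ (b∣cofactor k))))
               (∣n⇒∣m*n (M ^ e) (subst (+ x ∣_) (sym (pos-^ (denom k) (d ∸ e))) (ℕ⇒ℤ (b∣denom^[d∸e] k))))
      x∣∣num∣ᵈ : x ℕ.∣ ∣num∣ k ℕ.^ d
      x∣∣num∣ᵈ = subst (x ℕ.∣_) (abs-^ M d) (∣⇒∣ᵤ x∣Mᵈ)

    num-coprime-denom : ∀ k n → Coprime (∣num∣ k) (denom n)
    num-coprime-denom k n = coprime-^ʳ (d ℕ.^ n) (num-coprime k)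

    A≡num : ∀ k → A f (suc k) ≡ num k
    A≡num k = ↥-≃ (iter-≃ k) (num-coprime-denom k k)

    cofactor-cross : ∀ {Y E Y′ E′} → E * ↧ c ≡ Y ^ d → E′ * ↧ c ≡ Y′ ^ d → E * Y′ ^ d ≡ E′ * Y ^ d
    cofactor-cross {Y} {E} {Y′} {E′} EB≡Yᵈ E′B≡Y′ᵈ = ℤ.*-cancelʳ-≡ (E * Y′ ^ d) (E′ * Y ^ d) (↧ c) (begin
      E * Y′ ^ d * ↧ c    ≡⟨ xy∙z≈xz∙y E (Y′ ^ d) (↧ c) ⟩
      E * ↧ c * Y′ ^ d    ≡⟨ cong₂ _*_ EB≡Yᵈ (sym E′B≡Y′ᵈ) ⟩
      Y ^ d * (E′ * ↧ c)  ≡⟨ x∙yz≈yx∙z (Y ^ d) E′ (↧ c) ⟩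
      E′ * Y ^ d * ↧ c    ∎)
      where open ≡-Reasoning

    Φ-cross-difference : ∀ X Y E X′ Y′ E′ → Φ X Y E * Y′ ^ d - Φ X′ Y′ E′ * Y ^ d ≡
      (X ^ d * Y′ ^ d - X′ ^ d * Y ^ d) + (X ^ e * Y′ ^ e - X′ ^ e * Y ^ e) * (Y ^ (d ∸ e) * Y′ ^ (d ∸ e))
        + a * (E * Y′ ^ d - E′ * Y ^ d)
    Φ-cross-difference X Y E X′ Y′ E′ = begin
      Φ X Y E * Y′ ^ d - Φ X′ Y′ E′ * Y ^ d
        ≡⟨ cong₂ (λ u v → Φ X Y E * u - Φ X′ Y′ E′ * v) (^-split Y′ e≤d) (^-split Y e≤d) ⟩
      Φ X Y E * (P′ * Q′) - Φ X′ Y′ E′ * (P * Q)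
        ≡⟨ regroup (X ^ d) (X ^ e) (X′ ^ d) (X′ ^ e) P Q P′ Q′ a E E′ ⟩
      (X ^ d * (P′ * Q′) - X′ ^ d * (P * Q)) + (X ^ e * Q′ - X′ ^ e * Q) * (P * P′)
        + a * (E * (P′ * Q′) - E′ * (P * Q))
        ≡⟨ cong₂ (λ u v → (X ^ d * u - X′ ^ d * v) + (X ^ e * Q′ - X′ ^ e * Q) * (P * P′) + a * (E * u - E′ * v))
                 (sym (^-split Y′ e≤d)) (sym (^-split Y e≤d)) ⟩
      (X ^ d * Y′ ^ d - X′ ^ d * Y ^ d) + (X ^ e * Y′ ^ e - X′ ^ e * Y ^ e) * (P * P′)
        + a * (E * Y′ ^ d - E′ * Y ^ d) ∎
      where
      open ≡-Reasoning
      P = Y ^ (d ∸ e)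
      Q = Y ^ e
      P′ = Y′ ^ (d ∸ e)
      Q′ = Y′ ^ e
      regroup : ∀ xd xe x′d x′e p q p′ q′ a E E′ →
        (xd + xe * p + a * E) * (p′ * q′) - (x′d + x′e * p′ + a * E′) * (p * q) ≡
        (xd * (p′ * q′) - x′d * (p * q)) + (xe * q′ - x′e * q) * (p * p′) + a * (E * (p′ * q′) - E′ * (p * q))
      regroup = solve-∀

    Φ-congruence : ∀ {m X Y E X′ Y′ E′} → E * ↧ c ≡ Y ^ d → E′ * ↧ c ≡ Y′ ^ d →
                   m ∣ X * Y′ - X′ * Y → m ∣ Φ X Y E * Y′ ^ d - Φ X′ Y′ E′ * Y ^ d
    Φ-congruence {m} {X} {Y} {E} {X′} {Y′} {E′} EB≡Yᵈ E′B≡Y′ᵈ m∣XY′-X′Y =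
      subst (m ∣_) (sym (Φ-cross-difference X Y E X′ Y′ E′))
        (∣m∣n⇒∣m+n (∣m∣n⇒∣m+n (∣-cross-^ d m∣XY′-X′Y) (∣m⇒∣m*n _ (∣-cross-^ e m∣XY′-X′Y)))
                   (∣n⇒∣m*n a (subst (m ∣_) (sym cofactor-terms-cancel) (divides (+ 0) refl))))
      where
      cofactor-terms-cancel : E * Y′ ^ d - E′ * Y ^ d ≡ + 0
      cofactor-terms-cancel = trans (cong (_- E′ * Y ^ d) (cofactor-cross {Y} {E} {Y′} {E′} EB≡Yᵈ E′B≡Y′ᵈ))
                                    (ℤ.+-inverseʳ (E′ * Y ^ d))

    square∣Φ-aE : ∀ X Y E → X * X ∣ Φ X Y E - a * E
    square∣Φ-aE X Y E = subst (X * X ∣_) (sym (cancel (X ^ d) (X ^ e * Y ^ (d ∸ e)) (a * E)))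
      (∣m∣n⇒∣m+n (square∣^ X 2≤d) (∣m⇒∣m*n (Y ^ (d ∸ e)) (square∣^ X 2≤e)))
      where
      cancel : ∀ u v w → u + v + w - w ≡ u + v
      cancel = solve-∀

    num-congruence : ∀ j i → num i * num i ∣ num (suc (j ℕ.+ i)) * + denom j - num j * + denom (suc (j ℕ.+ i))
    num-congruence zero i = subst (num i * num i ∣_) (sym base-difference)
                              (∣m⇒∣m*n (↧ c) (square∣Φ-aE (num i) (+ denom i) (+ cofactor i)))
      where
      open ≡-Reasoning
      factor : ∀ u a E B → u * B - a * (E * B) ≡ (u - a * E) * B
      factor = solve-∀
      base-difference : num (suc i) * + denom 0 - a * + denom (suc i) ≡ (num (suc i) - a * + cofactor i) * ↧ c
      base-difference = begin
        num (suc i) * + denom 0 - a * + denom (suc i)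
          ≡⟨ cong₂ (λ u v → num (suc i) * u - a * v) (cong +_ (ℕ.^-identityʳ b))
                   (trans (+denom-suc i) (sym (+cofactor-* i))) ⟩
        num (suc i) * ↧ c - a * (+ cofactor i * ↧ c)
          ≡⟨ factor (num (suc i)) a (+ cofactor i) (↧ c) ⟩
        (num (suc i) - a * + cofactor i) * ↧ c ∎
    num-congruence (suc j) i = subst₂ (λ u v → num i * num i ∣ num (suc n) * u - num (suc j) * v)
      (sym (+denom-suc j)) (sym (+denom-suc n))
      (Φ-congruence (+cofactor-* n) (+cofactor-* j) (num-congruence j i))
      where
      n = suc (j ℕ.+ i)

    ∣num∣-square-congruence : SquareCongruence ∣num∣ denom
    ∣num∣-square-congruence {q} i j q∣tᵢtᵢ q∣tₙ = subst (q ℕ.∣_) (ℤ.abs-* (num j) (+ denom n)) (∣⇒∣ᵤ q∣num-j*Dₙ)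
      where
      n = suc (j ℕ.+ i)
      u = num n * + denom j
      v = num j * + denom n
      q∣u-v : + q ∣ u - v
      q∣u-v = ∣-trans (∣ᵤ⇒∣ (subst (q ℕ.∣_) (sym (ℤ.abs-* (num i) (num i))) q∣tᵢtᵢ)) (num-congruence j i)
      u-[u-v]≡v : ∀ u v → u - (u - v) ≡ v
      u-[u-v]≡v = solve-∀
      q∣num-j*Dₙ : + q ∣ v
      q∣num-j*Dₙ = subst (+ q ∣_) (u-[u-v]≡v u v) (∣m∣n⇒∣m-n (∣m⇒∣m*n {m = num n} (+ denom j) (∣ᵤ⇒∣ q∣tₙ)) q∣u-v)

    module _ (2b<∣a∣ : 2 ℕ.* b ℕ.< ℤ.∣ a ∣) where

      α : ℕ
      α = ℤ.∣ a ∣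

      triangle : ∀ k → ∣num∣ k ℕ.^ d ≤ ∣num∣ (suc k) ℕ.+ ∣num∣ k ℕ.^ e ℕ.* denom k ℕ.^ (d ∸ e) ℕ.+ α ℕ.* cofactor k
      triangle k = begin
        ∣num∣ k ℕ.^ d                        ≡⟨ abs-^ M d ⟨
        ℤ.∣ M ^ d ∣                          ≡⟨ cong ℤ.∣_∣ (isolate (M ^ d) Y Z) ⟩
        ℤ.∣ Φ′ - Y - Z ∣                     ≤⟨ ℤ.∣i-j∣≤∣i∣+∣j∣ (Φ′ - Y) Z ⟩
        ℤ.∣ Φ′ - Y ∣ ℕ.+ ℤ.∣ Z ∣             ≤⟨ ℕ.+-monoˡ-≤ ℤ.∣ Z ∣ (ℤ.∣i-j∣≤∣i∣+∣j∣ Φ′ Y) ⟩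
        ℤ.∣ Φ′ ∣ ℕ.+ ℤ.∣ Y ∣ ℕ.+ ℤ.∣ Z ∣
          ≡⟨ cong₂ (λ y z → ∣num∣ (suc k) ℕ.+ y ℕ.+ z) ∣Y∣ (ℤ.abs-* a (+ cofactor k)) ⟩
        ∣num∣ (suc k) ℕ.+ ∣num∣ k ℕ.^ e ℕ.* denom k ℕ.^ (d ∸ e) ℕ.+ α ℕ.* cofactor k ∎
        where
        open ℕ.≤-Reasoning
        M = num k
        Φ′ = num (suc k)
        Y = M ^ e * (+ denom k) ^ (d ∸ e)
        Z = a * + cofactor k
        isolate : ∀ x y z → x ≡ x + y + z - y - z
        isolate = solve-∀
        ∣Y∣ : ℤ.∣ Y ∣ ≡ ∣num∣ k ℕ.^ e ℕ.* denom k ℕ.^ (d ∸ e)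
        ∣Y∣ = trans (ℤ.abs-* (M ^ e) _) (cong₂ ℕ._*_ (abs-^ M e) (abs-^ (+ denom k) (d ∸ e)))

      growth : ∀ k → α ℕ.* denom k ≤ b ℕ.* ∣num∣ k →
               ∣num∣ k ℕ.* ∣num∣ k ≤ ∣num∣ (suc k) × α ℕ.* denom k ℕ.^ d ≤ b ℕ.* ∣num∣ (suc k)
      growth k αD≤bt = growth-step {{_}} {{denom-nonZero k}} 2≤e e<d 2b<∣a∣ αD≤bt (cofactor-* k) (triangle k)

      αdenom≤b∣num∣ : ∀ k → α ℕ.* denom k ≤ b ℕ.* ∣num∣ k
      αdenom≤b∣num∣ zero    = ℕ.≤-reflexive (trans (cong (α ℕ.*_) (ℕ.^-identityʳ b)) (ℕ.*-comm α b))
      αdenom≤b∣num∣ (suc k) = subst (λ D → α ℕ.* D ≤ b ℕ.* ∣num∣ (suc k)) (sym (denom-suc k))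
                                (proj₂ (growth k (αdenom≤b∣num∣ k)))

      1<∣num∣ : ∀ k → 1 < ∣num∣ k
      1<∣num∣ k = ℕ.≤-<-trans (ℕ.*-mono-≤ {1} {2} (s≤s z≤n) (ℕ.>-nonZero⁻¹ (denom k) {{denom-nonZero k}}))
                              (2*D<t {b} {{denom-nonZero k}} 2b<∣a∣ (αdenom≤b∣num∣ k))

      ∣num∣-nonZero : ∀ k → NonZero (∣num∣ k)
      ∣num∣-nonZero k = ℕ.>-nonZero (ℕ.<-trans (s≤s z≤n) (1<∣num∣ k))

      product : ℕ → ℕ
      product zero    = 1
      product (suc k) = product k ℕ.* ∣num∣ k

      product-nonZero : ∀ k → NonZero (product k)
      product-nonZero zero    = _
      product-nonZero (suc k) = ℕ.m*n≢0 (product k) (∣num∣ k) {{product-nonZero k}} {{∣num∣-nonZero k}}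

      product<∣num∣ : ∀ k → product k < ∣num∣ k
      product<∣num∣ zero    = 1<∣num∣ 0
      product<∣num∣ (suc k) = ℕ.<-≤-trans (ℕ.*-monoˡ-< (∣num∣ k) {{∣num∣-nonZero k}} (product<∣num∣ k))
                                          (proj₁ (growth k (αdenom≤b∣num∣ k)))

      ∣num∣∣product : ∀ {i k} → i < k → ∣num∣ i ℕ.∣ product k
      ∣num∣∣product {i} {suc k} i<1+k with ℕ.m≤n⇒m<n∨m≡n (ℕ.≤-pred i<1+k)
      ... | inj₁ i<k  = ℕ.∣m⇒∣m*n (∣num∣ k) (∣num∣∣product i<k)
      ... | inj₂ refl = ℕ.n∣m*n (product k)

      no-primitive⇒∣ₚ : ∀ k → InZsigmondy f (suc k) → ∣num∣ k ∣ₚ product k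
      no-primitive⇒∣ₚ k _ zero _ _ = ℕ.1∣ product k
      no-primitive⇒∣ₚ k (_ , no-primitive) {q} (suc r) q-prime q^1+r∣tₖ with ℕ.anyUpTo? (λ i → q ℕ.∣? ∣num∣ i) k
      ... | no ∄j = contradiction (q-prime , q∣Aₖ₊₁ , not-earlier) (no-primitive q)
        where
        q∣Aₖ₊₁ : q ℕ.∣ ℤ.∣ A f (suc k) ∣
        q∣Aₖ₊₁ = subst (λ z → q ℕ.∣ ℤ.∣ z ∣) (sym (A≡num k)) (ℕ.∣-trans (ℕ.m∣m*n (q ℕ.^ r)) q^1+r∣tₖ)
        not-earlier : ∀ m → 1 ≤ m → m < suc k → ¬ q ℕ.∣ ℤ.∣ A f m ∣
        not-earlier (suc j) _ (s≤s j<k) q∣Aⱼ₊₁ = ∄j (j , j<k , subst (λ z → q ℕ.∣ ℤ.∣ z ∣) (A≡num j) q∣Aⱼ₊₁)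
      ... | yes (j , j<k , q∣tⱼ) with least (λ i → q ℕ.∣? ∣num∣ i) q∣tⱼ
      ...   | i , i≤j , q∣tᵢ , first =
        ℕ.∣-trans (rigid-divisibility ∣num∣-square-congruence q-prime q∤denom q∣tᵢ first
                                      (ℕ.≤-trans i≤j (ℕ.<⇒≤ j<k)) (suc r) q^1+r∣tₖ)
                  (∣num∣∣product (ℕ.≤-<-trans i≤j j<k))
        where
        q∤denom : ∀ n → ¬ q ℕ.∣ denom n
        q∤denom n q∣Dₙ = ¬prime[1] (subst Prime (num-coprime-denom i n (q∣tᵢ , q∣Dₙ)) q-prime)

      zsigmondy-empty : ∀ k → ¬ InZsigmondy f (suc k)
      zsigmondy-empty k zsigmondy = ℕ.<⇒≱ (product<∣num∣ k)
        (ℕ.∣⇒≤ {{product-nonZero k}} (∣ₚ⇒∣ {{∣num∣-nonZero k}} (no-primitive⇒∣ₚ k zsigmondy)))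

theorem1p3 : (d e : ℕ) → 2 ≤ e → e < d → (c : ℚ) → ∣ c ∣ > (+ 2) / 1 →
    (n : ℕ) → InZsigmondy (poly d e c) n → n ≤ 6
theorem1p3 d e 2≤e e<d c ∣c∣>2 zero    (() , _)
theorem1p3 d e 2≤e e<d c ∣c∣>2 (suc k) zsigmondy =
  ⊥-elim (Orbit.zsigmondy-empty 2≤e e<d c (2<∣q∣⇒2↧q<∣↥q∣ c ∣c∣>2) k zsigmondy)
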